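{- Let $t\ge 0$ be an integer. (i) If $G$ is a chordal graph, then $\hat\beta_t(G)=1$. (ii) Let $s$ be a positive integer and let $G$ be an incomparability graph that has no $t$-shallow minor isomorphic to an induced star with $s$ leaves. Then $\hat\beta_t(G)\le s$.
   Context: All graphs are finite, simple and undirected. A $t$-shallow minor (or $t$-minor) of a graph $G$ is a graph obtained from $G$ by contracting pairwise disjoint connected subgraphs, each of radius at most $t$, into single vertices, and deleting vertices (but not edges). For a graph $H$, $\beta(H)$ denotes the clique cover number of $H$, i.e. the minimum number of cliques partitioning $V(H)$. For $x\in V(H)$, $H_x$ denotes the subgraph of $H$ induced by the closed neighborhood of $x$ (i.e. $x$ together with its neighbors). Let $\tilde\beta(H)=\min_{x\in V(H)}\beta(H_x)$. For a graph $G$ and $t\ge 0$, the largest reduced neighborhood clique cover number $\hat\beta_t(G)$ is the maximum of $\tilde\beta(H)$ over all $t$-shallow minors $H$ of $G$. A chordal graph is a graph with no chordless (induced) cycle of length at least $4$. An incomparability graph is a graph whose complement admits a transitive orientation. -}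

module Defs where

open import Data.Nat using (ℕ; zero; suc; _≤_)
open import Data.Fin using (Fin; toℕ)
import Data.Fin as F
open import Data.Bool using (Bool; true; false)
open import Data.Maybe using (Maybe; just)
open import Data.Product using (Σ; _×_; _,_)
open import Data.Sum using (_⊎_)
open import Relation.Nullary using (¬_)
open import Relation.Binary.PropositionalEquality using (_≡_; _≢_; refl)
open import Function.Definitions using (Injective)

record Graph : Set where
  field
    n      : ℕ
    adj    : Fin n → Fin n → Bool
    sym    : ∀ u v → adj u v ≡ adj v u
    irrefl : ∀ u → adj u u ≡ false
open Graph public

V : Graph → Set
V G = Fin (n G)

Edge : (G : Graph) → V G → V G → Set
Edge G u v = adj G u v ≡ true

-- i and j are consecutive on the cycle 0,1,...,k-1,0
CycAdj : (k : ℕ) → Fin k → Fin k → Set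
CycAdj k i j =
  (suc (toℕ i) ≡ toℕ j) ⊎ (suc (toℕ j) ≡ toℕ i)
  ⊎ ((toℕ i ≡ 0) × (suc (toℕ j) ≡ k)) ⊎ ((toℕ j ≡ 0) × (suc (toℕ i) ≡ k))

InducedCycle : (G : Graph) → ℕ → Set
InducedCycle G k =
  Σ (Fin k → V G) λ c →
    Injective _≡_ _≡_ c ×
    (∀ i j → (Edge G (c i) (c j) → CycAdj k i j) × (CycAdj k i j → Edge G (c i) (c j)))

Chordal : Graph → Set
Chordal G = ¬ (Σ ℕ λ k → (4 ≤ k) × InducedCycle G k)

IsTransitiveOrientationOfComplement : (G : Graph) → (V G → V G → Set) → Set
IsTransitiveOrientationOfComplement G D =
  (∀ u v → D u v → adj G u v ≡ false) ×
  (∀ u v → u ≢ v → adj G u v ≡ false → D u v ⊎ D v u) ×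
  (∀ u v → D u v → ¬ D v u) ×
  (∀ u v w → D u v → D v w → D u w)

Incomparability : Graph → Set₁
Incomparability G = Σ (V G → V G → Set) λ D → IsTransitiveOrientationOfComplement G D

-- WalkIn G B k u v : a walk of length ≤ k from u to v in G whose vertices
-- after u all lie in B.
data WalkIn (G : Graph) (B : V G → Set) : ℕ → V G → V G → Set where
  here : ∀ {k v} → WalkIn G B k v v
  step : ∀ {k u w v} → Edge G u w → B w → WalkIn G B k w v → WalkIn G B (suc k) u v

-- H is (isomorphic to) a t-shallow minor of G: the map bs assigns each
-- vertex of G to at most one branch set (indexed by vertices of H;
-- unassigned vertices are deleted).  Each branch set contains a centre c
-- from which every vertex of the branch set is reachable by a walk of
-- length ≤ t inside the branch set (so it is connected, of radius ≤ t, and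
-- nonempty).
IsShallowMinor : ℕ → (H G : Graph) → Set
IsShallowMinor t H G =
  Σ (V G → Maybe (V H)) λ bs →
    (∀ x → Σ (V G) λ c → (bs c ≡ just x) ×
       (∀ v → bs v ≡ just x → WalkIn G (λ w → bs w ≡ just x) t c v)) ×
    (∀ x y → x ≢ y →
       (Edge H x y → Σ (V G) λ u → Σ (V G) λ v → (bs u ≡ just x) × (bs v ≡ just y) × Edge G u v) ×
       ((Σ (V G) λ u → Σ (V G) λ v → (bs u ≡ just x) × (bs v ≡ just y) × Edge G u v) → Edge H x y))

-- A partition of the vertex subset S of H into (at most) k cliques of H,
-- i.e. a clique cover of the induced subgraph H[S] with k (possibly empty) classes.
CliqueCoverOn : (H : Graph) → (V H → Set) → ℕ → Set
CliqueCoverOn H S k =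
  Σ ((v : V H) → S v → Fin k) λ f →
    ∀ u v (su : S u) (sv : S v) → u ≢ v → f u su ≡ f v sv → Edge H u v

IsCliqueCoverNumberOn : (H : Graph) → (V H → Set) → ℕ → Set
IsCliqueCoverNumberOn H S k =
  CliqueCoverOn H S k × (∀ j → CliqueCoverOn H S j → k ≤ j)

ClosedNbhd : (H : Graph) → V H → V H → Set
ClosedNbhd H x v = (v ≡ x) ⊎ Edge H x v

IsBetaAt : (H : Graph) → V H → ℕ → Set
IsBetaAt H x k = IsCliqueCoverNumberOn H (ClosedNbhd H x) k

-- β̃(H) = k  (minimum of β(H_x) over x ∈ V(H); requires V(H) ≠ ∅)
IsBetaTilde : Graph → ℕ → Set
IsBetaTilde H k =
  (Σ (V H) λ x → IsBetaAt H x k) × (∀ x j → IsBetaAt H x j → k ≤ j)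

-- β̂_t(G) = k  (maximum of β̃(H) over the (nonempty) t-shallow minors H of G)
IsBetaHat : ℕ → Graph → ℕ → Set
IsBetaHat t G k =
  (Σ Graph λ H → IsShallowMinor t H G × IsBetaTilde H k) ×
  (∀ H j → IsShallowMinor t H G → IsBetaTilde H j → j ≤ k)

starAdj : ∀ {m} → Fin m → Fin m → Bool
starAdj F.zero    F.zero    = false
starAdj F.zero    (F.suc _) = true
starAdj (F.suc _) F.zero    = true
starAdj (F.suc _) (F.suc _) = false

starSym : ∀ {m} (u v : Fin m) → starAdj u v ≡ starAdj v u
starSym F.zero    F.zero    = refl
starSym F.zero    (F.suc _) = refl
starSym (F.suc _) F.zero    = refl
starSym (F.suc _) (F.suc _) = refl

starIrrefl : ∀ {m} (u : Fin m) → starAdj u u ≡ false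
starIrrefl F.zero    = refl
starIrrefl (F.suc _) = refl

Star : ℕ → Graph
Star s = record { n = suc s ; adj = starAdj ; sym = starSym ; irrefl = starIrrefl }

-- (i) A chordal graph G has a perfect elimination ordering (Dirac). In a minor of G, take the
-- branch set whose last vertex v comes earliest in the ordering: every neighbouring branch set
-- contains a neighbour of v later than v, these are pairwise adjacent, and so the branch set is
-- simplicial in the minor and β̃ = 1.
-- (ii) Comparing branch sets through their centres transports a transitive orientation of the
-- complement of G to every minor H, so H is an incomparability graph. In N(x) the orientation
-- orders the non-adjacent pairs, chains are induced stars at x, and induced stars of H are shallow
-- minors of G. So chains have at most s elements, and the heights of Mirsky's theorem cover N[x]
-- by s cliques.

module Submission where

open import Defs hiding (sym)
open import Data.Nat using (ℕ; zero; suc; _≤_; _<_; z≤n; s≤s; s≤s⁻¹; _≤?_)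
open import Data.Nat.Properties
open import Data.Nat.Induction using (<-rec)
open import Data.Fin using (Fin; toℕ; fromℕ<) renaming (zero to fzero; suc to fsuc)
import Data.Fin.Properties as Fin
import Data.Fin.Subset as Subset
open import Data.Fin.Subset.Properties using (∣p∣≤n; p⊂q⇒∣p∣<∣q∣)
open import Data.Vec using (tabulate)
open import Data.Vec.Properties using (lookup∘tabulate; lookup⇒[]=; []=⇒lookup)
open import Data.Bool using (true; false)
import Data.Bool.Properties as Bool
open import Data.Maybe using (Maybe; just; nothing; _>>=_)
open import Data.Maybe.Properties using (just-injective; ≡-dec)
open import Data.Product using (Σ; ∃; _×_; _,_; proj₁; proj₂; uncurry; map)
open import Data.Sum using (_⊎_; inj₁; inj₂; swap)
open import Data.Empty using (⊥; ⊥-elim)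
open import Data.Unit using (⊤; tt)
open import Function using (_∘_; flip; id; const)
open import Function.Bundles using (Equivalence)
open import Function.Definitions using (Injective)
open import Data.List using (List; allFin; filter)
import Data.List.Relation.Unary.All as All
open import Data.List.Membership.Propositional.Properties using (∈-allFin; ∈-filter⁺; ∈-filter⁻)
open import Data.List.Extrema.Nat using (argmax; argmin; argmax-all; f[xs]≤f[argmax]; f[argmin]≤f[xs])
open import Relation.Nullary
open import Relation.Nullary.Decidable using (_×-dec_; _⊎-dec_; _→-dec_; ¬?; toWitness; fromWitness)
open import Relation.Unary using () renaming (Decidable to Decidable₁)
open import Relation.Binary using (Decidable; Transitive; tri<; tri≈; tri>)
open import Relation.Binary.PropositionalEquality

NonEdge : (G : Graph) → V G → V G → Set
NonEdge G u v = adj G u v ≡ false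

edge-sym : ∀ G {u v} → Edge G u v → Edge G v u
edge-sym G {u} {v} e = trans (Graph.sym G v u) e

nonEdge-sym : ∀ G {u v} → NonEdge G u v → NonEdge G v u
nonEdge-sym G {u} {v} ne = trans (Graph.sym G v u) ne

edge⇒¬nonEdge : ∀ G {u v} → Edge G u v → ¬ NonEdge G u v
edge⇒¬nonEdge G e ne = contradiction (trans (sym e) ne) λ ()

edge-irrefl : ∀ G {u} → ¬ Edge G u u
edge-irrefl G {u} e = edge⇒¬nonEdge G e (Graph.irrefl G u)

edge⇒≢ : ∀ G {u v} → Edge G u v → u ≢ v
edge⇒≢ G e refl = edge-irrefl G e

edge? : ∀ G → Decidable (Edge G)
edge? G u v = adj G u v Bool.≟ true

nonEdge? : ∀ G → Decidable (NonEdge G)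
nonEdge? G u v = adj G u v Bool.≟ false

edge-or-nonEdge : ∀ G u v → Edge G u v ⊎ NonEdge G u v
edge-or-nonEdge G u v with adj G u v
... | true  = inj₁ refl
... | false = inj₂ refl

data Walk (G : Graph) (P : V G → Set) : V G → V G → Set where
  nil  : ∀ {a} → P a → Walk G P a a
  cons : ∀ {a c b} → P a → Edge G a c → Walk G P c b → Walk G P a b

module _ {G : Graph} {P : V G → Set} where

  Walk-head : ∀ {a b} → Walk G P a b → P a
  Walk-head (nil p)      = p
  Walk-head (cons p _ _) = p

  Walk-snoc : ∀ {a b c} → Walk G P a b → Edge G b c → P c → Walk G P a c
  Walk-snoc (nil p)      e pc = cons p e (nil pc)
  Walk-snoc (cons p f w) e pc = cons p f (Walk-snoc w e pc)

  infixr 5 _++ʷ_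
  _++ʷ_ : ∀ {a b c} → Walk G P a b → Walk G P b c → Walk G P a c
  nil _      ++ʷ w′ = w′
  cons p e w ++ʷ w′ = cons p e (w ++ʷ w′)

  Walk-reverse : ∀ {a b} → Walk G P a b → Walk G P b a
  Walk-reverse (nil p)      = nil p
  Walk-reverse (cons p e w) = Walk-snoc (Walk-reverse w) (edge-sym G e) p

  Walk-map : ∀ {Q : V G → Set} {a b} → (∀ {v} → P v → Q v) → Walk G P a b → Walk G Q a b
  Walk-map f (nil p)      = nil (f p)
  Walk-map f (cons p e w) = cons (f p) e (Walk-map f w)

  fromWalkIn : ∀ {k a b} → P a → WalkIn G P k a b → Walk G P a b
  fromWalkIn pa here          = nil pa
  fromWalkIn pa (step e pw w) = cons pa e (fromWalkIn pw w)

WalkIn-map : ∀ {G B B′ k a b} → (∀ {v} → B v → B′ v) → WalkIn G B k a b → WalkIn G B′ k a b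
WalkIn-map f here          = here
WalkIn-map f (step e bw w) = step e (f bw) (WalkIn-map f w)

-- Shallow minors

module ShallowMinor {t : ℕ} {H G : Graph} (M : IsShallowMinor t H G) where

  InBranch : V H → V G → Set
  InBranch x v = proj₁ M v ≡ just x

  centre : V H → V G
  centre x = proj₁ (proj₁ (proj₂ M) x)

  centre∈ : ∀ x → InBranch x (centre x)
  centre∈ x = proj₁ (proj₂ (proj₁ (proj₂ M) x))

  centre-walk : ∀ x {v} → InBranch x v → WalkIn G (InBranch x) t (centre x) v
  centre-walk x = proj₂ (proj₂ (proj₁ (proj₂ M) x)) _

  Link : V H → V H → Set
  Link x y = Σ (V G) λ u → Σ (V G) λ v → InBranch x u × InBranch y v × Edge G u v

  edge⇒link : ∀ {x y} → x ≢ y → Edge H x y → Link x y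
  edge⇒link x≢y = proj₁ (proj₂ (proj₂ M) _ _ x≢y)

  link⇒edge : ∀ {x y} → x ≢ y → Link x y → Edge H x y
  link⇒edge x≢y = proj₂ (proj₂ (proj₂ M) _ _ x≢y)

  branches-disjoint : ∀ {x y u v} → x ≢ y → InBranch x u → InBranch y v → u ≢ v
  branches-disjoint x≢y xu yv refl = x≢y (just-injective (trans (sym xu) yv))

  branch-nonEdge : ∀ {x y u v} → x ≢ y → NonEdge H x y → InBranch x u → InBranch y v →
                    NonEdge G u v
  branch-nonEdge {u = u} {v} x≢y ne xu yv with edge-or-nonEdge G u v
  ... | inj₁ e  = ⊥-elim (edge⇒¬nonEdge H (link⇒edge x≢y (u , v , xu , yv , e)) ne)
  ... | inj₂ ne′ = ne′

  branch-walk : ∀ {x a b} → InBranch x a → InBranch x b → Walk G (InBranch x) a b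
  branch-walk {x} xa xb =
    Walk-reverse (fromWalkIn (centre∈ x) (centre-walk x xa)) ++ʷ fromWalkIn (centre∈ x) (centre-walk x xb)

InducedEmbedding : Graph → Graph → Set
InducedEmbedding K H =
  Σ (V K → V H) λ e → Injective _≡_ _≡_ e × (∀ a b → adj K a b ≡ adj H (e a) (e b))

shallowMinor-refl : ∀ t G → IsShallowMinor t G G
shallowMinor-refl t G =
  just ,
  (λ x → x , refl , λ { _ refl → here }) ,
  λ x y _ → (λ e → x , y , refl , refl , e) , λ { (_ , _ , refl , refl , e) → e }

shallowMinor-induced : ∀ {t K H G} → InducedEmbedding K H → IsShallowMinor t H G → IsShallowMinor t K G
shallowMinor-induced {t} {K} {H} {G} (e , e-inj , e-adj) M = branch′ , centres , links
  where
  open ShallowMinor {t} {H} {G} M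

  preimage : V H → Maybe (V K)
  preimage y with Fin.any? (λ a → e a Fin.≟ y)
  ... | yes (a , _) = just a
  ... | no _        = nothing

  preimage-just : ∀ {y a} → preimage y ≡ just a → e a ≡ y
  preimage-just {y} with Fin.any? (λ a → e a Fin.≟ y)
  ... | yes (_ , ea≡y) = λ { refl → ea≡y }

  preimage-image : ∀ a → preimage (e a) ≡ just a
  preimage-image a with Fin.any? (λ b → e b Fin.≟ e a)
  ... | yes (_ , eb≡ea) = cong just (e-inj eb≡ea)
  ... | no none         = contradiction (a , refl) none

  branch′ : V G → Maybe (V K)
  branch′ v = proj₁ M v >>= preimage

  branch′⇒ : ∀ {v a} → branch′ v ≡ just a → InBranch (e a) v
  branch′⇒ {v} with proj₁ M v
  ... | just y  = cong just ∘ sym ∘ preimage-just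
  ... | nothing = λ ()

  ⇒branch′ : ∀ {a v} → InBranch (e a) v → branch′ v ≡ just a
  ⇒branch′ {a} eq rewrite eq = preimage-image a

  centres : ∀ a → Σ (V G) λ c → (branch′ c ≡ just a) ×
              (∀ v → branch′ v ≡ just a → WalkIn G (λ w → branch′ w ≡ just a) t c v)
  centres a = centre (e a) , ⇒branch′ (centre∈ (e a)) ,
              λ v av → WalkIn-map ⇒branch′ (centre-walk (e a) (branch′⇒ av))

  Link′ : V K → V K → Set
  Link′ a b = Σ (V G) λ u → Σ (V G) λ v → (branch′ u ≡ just a) × (branch′ v ≡ just b) × Edge G u v

  links : ∀ a b → a ≢ b → (Edge K a b → Link′ a b) × (Link′ a b → Edge K a b)
  links a b a≢b = to , from
    where
    ea≢eb : e a ≢ e b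
    ea≢eb = a≢b ∘ e-inj
    to : Edge K a b → Link′ a b
    to ab with edge⇒link ea≢eb (trans (sym (e-adj a b)) ab)
    ... | u , v , au , bv , uv = u , v , ⇒branch′ au , ⇒branch′ bv , uv
    from : Link′ a b → Edge K a b
    from (u , v , au , bv , uv) =
      trans (e-adj a b) (link⇒edge ea≢eb (u , v , branch′⇒ au , branch′⇒ bv , uv))

record InducedStarAt (H : Graph) (x : V H) (s : ℕ) : Set where
  field
    leaf  : Fin s → V H
    spoke : ∀ i → Edge H x (leaf i)
    apart : ∀ {i j} → i ≢ j → leaf i ≢ leaf j × NonEdge H (leaf i) (leaf j)

star-embedding : ∀ {H x s} → InducedStarAt H x s → InducedEmbedding (Star s) H
star-embedding {H} {x} {s} star = e , e-inj , e-adj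
  where
  open InducedStarAt star
  e : Fin (suc s) → V H
  e fzero    = x
  e (fsuc i) = leaf i

  e-inj : Injective _≡_ _≡_ e
  e-inj {fzero}  {fzero}  _  = refl
  e-inj {fzero}  {fsuc j} eq = contradiction eq (edge⇒≢ H (spoke j))
  e-inj {fsuc i} {fzero}  eq = contradiction (sym eq) (edge⇒≢ H (spoke i))
  e-inj {fsuc i} {fsuc j} eq with i Fin.≟ j
  ... | yes i≡j = cong fsuc i≡j
  ... | no i≢j  = contradiction eq (proj₁ (apart i≢j))

  e-adj : ∀ a b → starAdj a b ≡ adj H (e a) (e b)
  e-adj fzero    fzero    = sym (Graph.irrefl H x)
  e-adj fzero    (fsuc j) = sym (spoke j)
  e-adj (fsuc i) fzero    = sym (edge-sym H (spoke i))
  e-adj (fsuc i) (fsuc j) with i Fin.≟ j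
  ... | yes refl = sym (Graph.irrefl H (leaf i))
  ... | no i≢j   = sym (proj₂ (apart i≢j))

inducedStar⇒shallowMinor : ∀ {t H G x s} → IsShallowMinor t H G → InducedStarAt H x s →
                           IsShallowMinor t (Star s) G
inducedStar⇒shallowMinor {t} {H} {G} {s = s} M star =
  shallowMinor-induced {t} {Star s} {H} {G} (star-embedding star) M

-- Chains and heights

Chain : ∀ {A : Set} → (A → A → Set) → ℕ → A → Set
Chain {A} _≺_ k z = Σ (ℕ → A) λ g → g 0 ≡ z × (∀ j → j < k → g (suc j) ≺ g j)

chain-≺ : ∀ {A : Set} {_≺_ : A → A → Set} → Transitive _≺_ → ∀ {g : ℕ → A} {k} →
          (∀ j → j < k → g (suc j) ≺ g j) → ∀ {i j} → i < j → j ≤ k → g j ≺ g i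
chain-≺ {_≺_ = _≺_} ≺-trans {g} links {i} {suc j} i<1+j 1+j≤k with m<1+n⇒m<n∨m≡n i<1+j
... | inj₂ refl = links i 1+j≤k
... | inj₁ i<j  = ≺-trans {g (suc j)} {g j} {g i} (links j 1+j≤k)
                   (chain-≺ {_≺_ = _≺_} ≺-trans {g} links i<j (<⇒≤ 1+j≤k))

module Height {m : ℕ} (_≺_ : Fin m → Fin m → Set) (_≺?_ : Decidable _≺_) where

  extend : ∀ {y z} → Dec (y ≺ z) → ℕ → ℕ
  extend (yes _) h = suc h
  extend (no _)  _ = 0

  -- height i z is the length of a longest chain of at most i links descending from z.
  height    : ℕ → Fin m → ℕ
  candidate : ℕ → Fin m → Fin m → ℕ
  height zero    z = 0
  height (suc i) z = candidate i z (argmax (candidate i z) z (allFin m))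
  candidate i z y = extend (y ≺? z) (height i y)

  candidate≤height : ∀ i z y → candidate i z y ≤ height (suc i) z
  candidate≤height i z y = All.lookup (f[xs]≤f[argmax] {f = candidate i z} z (allFin m)) (∈-allFin y)

  extend-yes : ∀ {y z h} (d : Dec (y ≺ z)) → y ≺ z → extend d h ≡ suc h
  extend-yes (yes _) _ = refl
  extend-yes (no ¬r) r = contradiction r ¬r

  extend-pos : ∀ {y z h k} (d : Dec (y ≺ z)) → suc k ≤ extend d h → y ≺ z × k ≤ h
  extend-pos (yes r) 1+k≤1+h = r , s≤s⁻¹ 1+k≤1+h

  prepend : ∀ {k y z} → y ≺ z → Chain _≺_ k y → Chain _≺_ (suc k) z
  prepend {z = z} r (g , g0≡y , links) =
    (λ { zero → z ; (suc j) → g j }) , refl ,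
    λ { zero _ → subst (_≺ z) (sym g0≡y) r ; (suc j) 1+j<1+k → links j (s≤s⁻¹ 1+j<1+k) }

  chain-from-height : ∀ i k z → k ≤ height i z → Chain _≺_ k z
  chain-from-height i       zero    z _  = (λ _ → z) , refl , λ _ ()
  chain-from-height (suc i) (suc k) z le with extend-pos _ le
  ... | r , k≤h = prepend r (chain-from-height i k _ k≤h)

  height-from-chain : ∀ k z → Chain _≺_ k z → ∀ i → k ≤ i → k ≤ height i z
  height-from-chain zero    _ _ _ _ = z≤n
  height-from-chain (suc k) _ (g , refl , links) (suc i) (s≤s k≤i) = begin
    suc k                   ≤⟨ s≤s (height-from-chain k (g 1) tail i k≤i) ⟩
    suc (height i (g 1))    ≡⟨ sym (extend-yes (g 1 ≺? g 0) (links 0 (s≤s z≤n))) ⟩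
    candidate i (g 0) (g 1) ≤⟨ candidate≤height i (g 0) (g 1) ⟩
    height (suc i) (g 0)    ∎
    where
    open ≤-Reasoning
    tail : Chain _≺_ k (g 1)
    tail = (λ j → g (suc j)) , refl , λ j j<k → links (suc j) (s≤s j<k)

  module Bounded (s : ℕ) (short : ∀ {k z} → Chain _≺_ k z → k < s) where

    height-mono : ∀ {y z} → y ≺ z → height s y < height s z
    height-mono {y} {z} r = begin-strict
      height s y       <⟨ ≤-reflexive (sym (extend-yes (y ≺? z) r)) ⟩
      candidate s z y  ≤⟨ candidate≤height s z y ⟩
      height (suc s) z ≤⟨ height-from-chain _ z chain s (<⇒≤ (short chain)) ⟩
      height s z       ∎
      where
      open ≤-Reasoning
      chain : Chain _≺_ (height (suc s) z) z
      chain = chain-from-height (suc s) _ z ≤-refl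

    rank : Fin m → Fin s
    rank z = fromℕ< (short (chain-from-height s _ z ≤-refl))

    rank-mono : ∀ {y z} → y ≺ z → toℕ (rank y) < toℕ (rank z)
    rank-mono r = subst₂ _<_ (sym (Fin.toℕ-fromℕ< _)) (sym (Fin.toℕ-fromℕ< _)) (height-mono r)

mirsky : ∀ {m} (_≺_ : Fin m → Fin m → Set) → Decidable _≺_ → (s : ℕ) →
         (∀ {k z} → Chain _≺_ k z → k < s) →
         Σ (Fin m → Fin s) λ rank → ∀ {y z} → y ≺ z → toℕ (rank y) < toℕ (rank z)
mirsky _≺_ _≺?_ s short = rank , rank-mono
  where open Height _≺_ _≺?_ ; open Bounded s short

-- Incomparability graphs

module Orientation {G : Graph} {D : V G → V G → Set} (TO : IsTransitiveOrientationOfComplement G D) where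

  D⇒nonEdge : ∀ {u v} → D u v → NonEdge G u v
  D⇒nonEdge = proj₁ TO _ _

  D-total : ∀ {u v} → u ≢ v → NonEdge G u v → D u v ⊎ D v u
  D-total = proj₁ (proj₂ TO) _ _

  D-asym : ∀ {u v} → D u v → ¬ D v u
  D-asym = proj₁ (proj₂ (proj₂ TO)) _ _

  D-trans : ∀ {u v w} → D u v → D v w → D u w
  D-trans = proj₂ (proj₂ (proj₂ TO)) _ _ _

  D-irrefl : ∀ {u} → ¬ D u u
  D-irrefl d = D-asym d d

  D⇒≢ : ∀ {u v} → D u v → u ≢ v
  D⇒≢ d refl = D-irrefl d

  D? : Decidable D
  D? u v with u Fin.≟ v | edge-or-nonEdge G u v
  ... | yes refl | _      = no D-irrefl
  ... | no _     | inj₁ e = no (edge⇒¬nonEdge G e ∘ D⇒nonEdge)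
  ... | no u≢v   | inj₂ ne with D-total u≢v ne
  ...   | inj₁ d = yes d
  ...   | inj₂ d = no (D-asym d)

  D-along-walk : ∀ {B : V G → Set} {v a b} → Walk G B a b →
                 (∀ {w} → B w → v ≢ w × NonEdge G v w) → D v a → D v b
  D-along-walk (nil _)      avoid d = d
  D-along-walk (cons _ e w) avoid d with uncurry D-total (avoid (Walk-head w))
  ... | inj₁ d′ = D-along-walk w avoid d′
  ... | inj₂ d′ = ⊥-elim (edge⇒¬nonEdge G (edge-sym G e) (D⇒nonEdge (D-trans d′ d)))

flip-orientation : ∀ {G D} → IsTransitiveOrientationOfComplement G D →
                   IsTransitiveOrientationOfComplement G (flip D)
flip-orientation {G} (nonEdge , total , asym , trans) =
  (λ u v d → nonEdge-sym G (nonEdge v u d)) ,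
  (λ u v u≢v ne → swap (total u v u≢v ne)) ,
  (λ u v → asym v u) ,
  (λ u v w d d′ → trans w v u d′ d)

shallowMinor-incomparability : ∀ {t H G} → IsShallowMinor t H G → Incomparability G → Incomparability H
shallowMinor-incomparability {t} {H} {G} M (D , TO) =
  BranchBelow , below⇒nonEdge , below-total , below-asym , below-trans
  where
  open ShallowMinor {t} {H} {G} M
  open Orientation TO

  BranchBelow : V H → V H → Set
  BranchBelow y z = ∀ {u v} → InBranch y u → InBranch z v → D u v

  separated : ∀ {y z u w} → y ≢ z → NonEdge H y z → InBranch y u → InBranch z w → u ≢ w × NonEdge G u w
  separated y≢z ne yu zw = branches-disjoint y≢z yu zw , branch-nonEdge y≢z ne yu zw

  centres⇒branches : ∀ {y z} → y ≢ z → NonEdge H y z → D (centre y) (centre z) → BranchBelow y z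
  centres⇒branches {y} {z} y≢z ne d yu zv =
    D-along-walk (fromWalkIn (centre∈ z) (centre-walk z zv)) (separated y≢z ne yu) u<centre
    where
    u<centre : D _ (centre z)
    u<centre = Orientation.D-along-walk {G} {flip D} (flip-orientation {G} {D} TO)
                 (fromWalkIn (centre∈ y) (centre-walk y yu))
                 (λ yw → map (_∘ sym) (nonEdge-sym G) (separated y≢z ne yw (centre∈ z))) d

  below⇒nonEdge : ∀ y z → BranchBelow y z → NonEdge H y z
  below⇒nonEdge y z below with edge-or-nonEdge H y z
  ... | inj₂ ne = ne
  ... | inj₁ e with edge⇒link (edge⇒≢ H e) e
  ...   | (u , v , yu , zv , uv) = ⊥-elim (edge⇒¬nonEdge G uv (D⇒nonEdge (below yu zv)))

  below-total : ∀ y z → y ≢ z → NonEdge H y z → BranchBelow y z ⊎ BranchBelow z y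
  below-total y z y≢z ne with uncurry D-total (separated y≢z ne (centre∈ y) (centre∈ z))
  ... | inj₁ d = inj₁ (centres⇒branches y≢z ne d)
  ... | inj₂ d = inj₂ (centres⇒branches (y≢z ∘ sym) (nonEdge-sym H ne) d)

  below-asym : ∀ y z → BranchBelow y z → ¬ BranchBelow z y
  below-asym y z b b′ = D-asym (b (centre∈ y) (centre∈ z)) (b′ (centre∈ z) (centre∈ y))

  below-trans : ∀ y z w → BranchBelow y z → BranchBelow z w → BranchBelow y w
  below-trans y z w b b′ yu wv = D-trans (b yu (centre∈ z)) (b′ (centre∈ z) wv)

-- Non-adjacent vertices of N(x) are comparable in the orientation and its chains are induced
-- stars at x, so ranking N(x) by height leaves only adjacent vertices on a common level.
neighbourhood-cover : ∀ H → Incomparability H → ∀ x s → ¬ InducedStarAt H x s →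
                      CliqueCoverOn H (ClosedNbhd H x) s
neighbourhood-cover H (D , TO) x s no-star = (λ v _ → rank v) , same-rank⇒edge
  where
  open Orientation {H} {D} TO

  _≺_ : V H → V H → Set
  y ≺ z = Edge H x y × Edge H x z × D y z

  _≺?_ : Decidable _≺_
  y ≺? z = edge? H x y ×-dec (edge? H x z ×-dec D? y z)

  ≺-trans : Transitive _≺_
  ≺-trans (xy , _ , d) (_ , xw , d′) = xy , xw , D-trans d d′

  chain⇒star : ∀ {k z} → Chain _≺_ k z → s ≤ k → InducedStarAt H x s
  chain⇒star {k} (g , _ , links) s≤k = record { leaf = leaf ; spoke = spoke ; apart = apart }
    where
    leaf : Fin s → V H
    leaf i = g (toℕ i)
    bounded : ∀ i → toℕ i < k
    bounded i = <-≤-trans (Fin.toℕ<n i) s≤k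
    ordered : ∀ {i j} → i < j → j ≤ k → g j ≺ g i
    ordered = chain-≺ {_≺_ = _≺_} ≺-trans {g} links
    spoke : ∀ i → Edge H x (leaf i)
    spoke i = proj₁ (proj₂ (links (toℕ i) (bounded i)))
    apart : ∀ {i j} → i ≢ j → leaf i ≢ leaf j × NonEdge H (leaf i) (leaf j)
    apart {i} {j} i≢j with <-cmp (toℕ i) (toℕ j)
    ... | tri< i<j _ _ = let (_ , _ , d) = ordered i<j (<⇒≤ (bounded j))
                         in D⇒≢ d ∘ sym , nonEdge-sym H (D⇒nonEdge d)
    ... | tri≈ _ i≡j _ = contradiction (Fin.toℕ-injective i≡j) i≢j
    ... | tri> _ _ j<i = let (_ , _ , d) = ordered j<i (<⇒≤ (bounded i))
                         in D⇒≢ d , D⇒nonEdge d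

  graded : Σ (V H → Fin s) λ rank → ∀ {y z} → y ≺ z → toℕ (rank y) < toℕ (rank z)
  graded = mirsky _≺_ _≺?_ s λ chain → ≰⇒> (no-star ∘ chain⇒star chain)

  rank : V H → Fin s
  rank = proj₁ graded

  rank-mono : ∀ {y z} → y ≺ z → toℕ (rank y) < toℕ (rank z)
  rank-mono = proj₂ graded

  same-rank⇒edge : ∀ u v (su : ClosedNbhd H x u) (sv : ClosedNbhd H x v) → u ≢ v →
                   rank u ≡ rank v → Edge H u v
  same-rank⇒edge u v (inj₁ refl) (inj₁ refl) u≢v _ = contradiction refl u≢v
  same-rank⇒edge u v (inj₁ refl) (inj₂ xv)   _   _ = xv
  same-rank⇒edge u v (inj₂ xu)   (inj₁ refl) _   _ = edge-sym H xu
  same-rank⇒edge u v (inj₂ xu)   (inj₂ xv)   u≢v same with edge-or-nonEdge H u v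
  ... | inj₁ uv = uv
  ... | inj₂ ne with D-total u≢v ne
  ...   | inj₁ d = ⊥-elim (<-irrefl (cong toℕ same) (rank-mono (xu , xv , d)))
  ...   | inj₂ d = ⊥-elim (<-irrefl (cong toℕ (sym same)) (rank-mono (xv , xu , d)))

-- Induced paths and cycles

least : ∀ {P : ℕ → Set} → Decidable₁ P → ∀ {k} → P k →
        Σ ℕ λ i → i ≤ k × P i × (∀ {j} → j < i → ¬ P j)
least {P} P? {k} = <-rec Least search k
  where
  Least : ℕ → Set
  Least k = P k → Σ ℕ λ i → i ≤ k × P i × (∀ {j} → j < i → ¬ P j)
  search : ∀ k → (∀ {j} → j < k → Least j) → Least k
  search k smaller pk with anyUpTo? P? k
  ... | no none = k , ≤-refl , pk , λ j<k pj → none (_ , j<k , pj)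
  ... | yes (j , j<k , pj) with smaller j<k pj
  ...   | i , i≤j , pi , minimal = i , ≤-trans i≤j (<⇒≤ j<k) , pi , minimal

≤-suc-split : ∀ {a i} → a ≤ suc i → a ≤ i ⊎ a ≡ suc i
≤-suc-split a≤1+i with m≤n⇒m<n∨m≡n a≤1+i
... | inj₁ a<1+i = inj₁ (s≤s⁻¹ a<1+i)
... | inj₂ a≡1+i = inj₂ a≡1+i

endpoint-or-interior : ∀ {a k} → a ≤ k → a ≡ 0 ⊎ a ≡ k ⊎ (0 < a × a < k)
endpoint-or-interior {zero}  _   = inj₁ refl
endpoint-or-interior {suc a} a≤k with m≤n⇒m<n∨m≡n a≤k
... | inj₁ a<k = inj₂ (inj₂ (s≤s z≤n , a<k))
... | inj₂ a≡k = inj₂ (inj₁ a≡k)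

CycAdj-sym : ∀ {m i j} → CycAdj m i j → CycAdj m j i
CycAdj-sym (inj₁ p)               = inj₂ (inj₁ p)
CycAdj-sym (inj₂ (inj₁ p))        = inj₁ p
CycAdj-sym (inj₂ (inj₂ (inj₁ p))) = inj₂ (inj₂ (inj₂ p))
CycAdj-sym (inj₂ (inj₂ (inj₂ p))) = inj₂ (inj₂ (inj₁ p))

module _ {G : Graph} where

  record InducedPath (k : ℕ) (q : ℕ → V G) : Set where
    field
      chordless : ∀ {a b} → a ≤ k → b ≤ k → Edge G (q a) (q b) → suc a ≡ b ⊎ suc b ≡ a
      linked    : ∀ {a} → a < k → Edge G (q a) (q (suc a))
      injective : ∀ {a b} → a ≤ k → b ≤ k → q a ≡ q b → a ≡ b

  single : ∀ v → InducedPath 0 (λ _ → v)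
  single v = record
    { chordless = λ { z≤n z≤n e → ⊥-elim (edge-irrefl G e) }
    ; linked    = λ ()
    ; injective = λ { z≤n z≤n _ → refl }
    }

  InducedPath-prefix : ∀ {k q i} → InducedPath k q → i ≤ k → InducedPath i q
  InducedPath-prefix path i≤k = record
    { chordless = λ a≤i b≤i → chordless (≤-trans a≤i i≤k) (≤-trans b≤i i≤k)
    ; linked    = λ a<i → linked (<-≤-trans a<i i≤k)
    ; injective = λ a≤i b≤i → injective (≤-trans a≤i i≤k) (≤-trans b≤i i≤k)
    }
    where open InducedPath path

  snocAt : ℕ → (ℕ → V G) → V G → ℕ → V G
  snocAt i q w l with l ≤? i
  ... | yes _ = q l
  ... | no _  = w

  snocAt-≤ : ∀ i q w {l} → l ≤ i → snocAt i q w l ≡ q l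
  snocAt-≤ i q w {l} l≤i with l ≤? i
  ... | yes _   = refl
  ... | no l≰i = contradiction l≤i l≰i

  snocAt-last : ∀ i q w → snocAt i q w (suc i) ≡ w
  snocAt-last i q w with suc i ≤? i
  ... | yes 1+i≤i = contradiction 1+i≤i 1+n≰n
  ... | no _      = refl

  InducedPath-snoc : ∀ {i q w} → InducedPath i q → Edge G (q i) w → q i ≢ w →
                     (∀ {a} → a < i → ¬ (q a ≡ w ⊎ Edge G (q a) w)) → InducedPath (suc i) (snocAt i q w)
  InducedPath-snoc {i} {q} {w} path iw i≢w fresh = record
    { chordless = chordless′ ; linked = linked′ ; injective = injective′ }
    where
    open InducedPath path
    qw : ℕ → V G
    qw = snocAt i q w

    at : ∀ {a} → a ≤ i → qw a ≡ q a
    at = snocAt-≤ i q w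

    last : qw (suc i) ≡ w
    last = snocAt-last i q w

    new-edge : ∀ {a} → a ≤ i → Edge G (q a) w → a ≡ i
    new-edge a≤i aw with m≤n⇒m<n∨m≡n a≤i
    ... | inj₁ a<i = contradiction (inj₂ aw) (fresh a<i)
    ... | inj₂ a≡i = a≡i

    new-vertex : ∀ {a} → a ≤ i → q a ≢ w
    new-vertex a≤i a≡w with m≤n⇒m<n∨m≡n a≤i
    ... | inj₁ a<i = fresh a<i (inj₁ a≡w)
    ... | inj₂ refl = i≢w a≡w

    chordless′ : ∀ {a b} → a ≤ suc i → b ≤ suc i → Edge G (qw a) (qw b) → suc a ≡ b ⊎ suc b ≡ a
    chordless′ a≤ b≤ e with ≤-suc-split a≤ | ≤-suc-split b≤
    ... | inj₁ a≤i | inj₁ b≤i = chordless a≤i b≤i (subst₂ (Edge G) (at a≤i) (at b≤i) e)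
    ... | inj₁ a≤i | inj₂ refl = inj₁ (cong suc (new-edge a≤i (subst₂ (Edge G) (at a≤i) last e)))
    ... | inj₂ refl | inj₁ b≤i =
          inj₂ (cong suc (new-edge b≤i (edge-sym G (subst₂ (Edge G) last (at b≤i) e))))
    ... | inj₂ refl | inj₂ refl = ⊥-elim (edge-irrefl G e)

    linked′ : ∀ {a} → a < suc i → Edge G (qw a) (qw (suc a))
    linked′ a<1+i with m≤n⇒m<n∨m≡n (s≤s⁻¹ a<1+i)
    ... | inj₁ a<i  = subst₂ (Edge G) (sym (at (<⇒≤ a<i))) (sym (at a<i)) (linked a<i)
    ... | inj₂ refl = subst₂ (Edge G) (sym (at ≤-refl)) (sym last) iw

    injective′ : ∀ {a b} → a ≤ suc i → b ≤ suc i → qw a ≡ qw b → a ≡ b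
    injective′ a≤ b≤ eq with ≤-suc-split a≤ | ≤-suc-split b≤
    ... | inj₁ a≤i | inj₁ b≤i = injective a≤i b≤i (trans (sym (at a≤i)) (trans eq (at b≤i)))
    ... | inj₁ a≤i | inj₂ refl = ⊥-elim (new-vertex a≤i (trans (sym (at a≤i)) (trans eq last)))
    ... | inj₂ refl | inj₁ b≤i = ⊥-elim (new-vertex b≤i (trans (sym (at b≤i)) (trans (sym eq) last)))
    ... | inj₂ refl | inj₂ refl = refl

  -- Extend by a neighbour w of the last vertex, first cutting back to the earliest vertex
  -- that is w or adjacent to w.
  InducedPath-extend : ∀ {k q w} → InducedPath k q → Edge G (q k) w →
    Σ ℕ λ k′ → Σ (ℕ → V G) λ q′ → InducedPath k′ q′ × q′ 0 ≡ q 0 × q′ k′ ≡ w ×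
      (∀ {l} → l < k′ → l ≤ k × q′ l ≡ q l)
  InducedPath-extend {k} {q} {w} path kw with least meets? {k} (inj₂ kw)
    where
    meets? : Decidable₁ (λ a → q a ≡ w ⊎ Edge G (q a) w)
    meets? a = (q a Fin.≟ w) ⊎-dec edge? G (q a) w
  ... | i , i≤k , inj₁ i≡w , _ =
        i , q , InducedPath-prefix path i≤k , refl , i≡w , λ l<i → ≤-trans (<⇒≤ l<i) i≤k , refl
  ... | i , i≤k , inj₂ iw , fresh =
        suc i , snocAt i q w , InducedPath-snoc (InducedPath-prefix path i≤k) iw i≢w fresh ,
        snocAt-≤ i q w z≤n , snocAt-last i q w ,
        λ l<1+i → ≤-trans (s≤s⁻¹ l<1+i) i≤k , snocAt-≤ i q w (s≤s⁻¹ l<1+i)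
    where
    i≢w : q i ≢ w
    i≢w i≡w = edge-irrefl G (subst (Edge G (q i)) (sym i≡w) iw)

  close-cycle : ∀ {k q x} → InducedPath k q → Edge G x (q 0) → Edge G x (q k) →
                (∀ {a} → a ≤ k → Edge G x (q a) → a ≡ 0 ⊎ a ≡ k) → (∀ {a} → a ≤ k → q a ≢ x) →
                InducedCycle G (suc (suc k))
  close-cycle {k} {q} {x} path x-first x-last x-ends x-off = cyc , cyc-injective , λ i j → to i j , from i j
    where
    open InducedPath path

    cyc : Fin (suc (suc k)) → V G
    cyc fzero    = x
    cyc (fsuc i) = q (toℕ i)

    bound : ∀ (i : Fin (suc k)) → toℕ i ≤ k
    bound = Fin.toℕ≤pred[n]

    cyc-injective : Injective _≡_ _≡_ cyc
    cyc-injective {fzero}  {fzero}  _  = refl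
    cyc-injective {fzero}  {fsuc j} eq = contradiction (sym eq) (x-off (bound j))
    cyc-injective {fsuc i} {fzero}  eq = contradiction eq (x-off (bound i))
    cyc-injective {fsuc i} {fsuc j} eq = cong fsuc (Fin.toℕ-injective (injective (bound i) (bound j) eq))

    to : ∀ i j → Edge G (cyc i) (cyc j) → CycAdj (suc (suc k)) i j
    to fzero    fzero    e = ⊥-elim (edge-irrefl G e)
    to fzero    (fsuc j) e with x-ends (bound j) e
    ... | inj₁ j≡0 = inj₁ (cong suc (sym j≡0))
    ... | inj₂ j≡k = inj₂ (inj₂ (inj₁ (refl , cong (suc ∘ suc) j≡k)))
    to (fsuc i) fzero    e = CycAdj-sym (to fzero (fsuc i) (edge-sym G e))
    to (fsuc i) (fsuc j) e with chordless (bound i) (bound j) e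
    ... | inj₁ i→j = inj₁ (cong suc i→j)
    ... | inj₂ j→i = inj₂ (inj₁ (cong suc j→i))

    consecutive : ∀ {a b} → suc a ≡ b → b ≤ k → Edge G (q a) (q b)
    consecutive refl b≤k = linked b≤k

    from-x : ∀ j → CycAdj (suc (suc k)) fzero (fsuc j) → Edge G x (q (toℕ j))
    from-x j (inj₁ 1≡1+j)               = subst (Edge G x ∘ q) (suc-injective 1≡1+j) x-first
    from-x j (inj₂ (inj₁ ()))
    from-x j (inj₂ (inj₂ (inj₁ (_ , j≡k)))) =
      subst (Edge G x ∘ q) (sym (suc-injective (suc-injective j≡k))) x-last
    from-x j (inj₂ (inj₂ (inj₂ (() , _))))

    from : ∀ i j → CycAdj (suc (suc k)) i j → Edge G (cyc i) (cyc j)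
    from fzero    fzero    (inj₁ ())
    from fzero    fzero    (inj₂ (inj₁ ()))
    from fzero    fzero    (inj₂ (inj₂ (inj₁ (_ , ()))))
    from fzero    fzero    (inj₂ (inj₂ (inj₂ (_ , ()))))
    from fzero    (fsuc j) c = from-x j c
    from (fsuc i) fzero    c = edge-sym G (from-x i (CycAdj-sym c))
    from (fsuc i) (fsuc j) (inj₁ i→j)        = consecutive (suc-injective i→j) (bound j)
    from (fsuc i) (fsuc j) (inj₂ (inj₁ j→i)) = edge-sym G (consecutive (suc-injective j→i) (bound i))
    from (fsuc i) (fsuc j) (inj₂ (inj₂ (inj₁ (() , _))))
    from (fsuc i) (fsuc j) (inj₂ (inj₂ (inj₂ (() , _))))

  Via : (V G → Set) → V G → ℕ → (ℕ → V G) → Set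
  Via C s k q = InducedPath k q × q 0 ≡ s × (∀ {l} → 0 < l → l ≤ k → C (q l))

  Via-extend : ∀ {C s k q w} → Via C s k q → Edge G (q k) w → C w →
               Σ ℕ λ k′ → Σ (ℕ → V G) λ q′ → Via C s k′ q′ × q′ k′ ≡ w
  Via-extend {C} (path , q0≡s , inner) kw cw with InducedPath-extend path kw
  ... | k′ , q′ , path′ , q′0≡q0 , q′k′≡w , prefix =
        k′ , q′ , (path′ , trans q′0≡q0 q0≡s , inner′) , q′k′≡w
    where
    inner′ : ∀ {l} → 0 < l → l ≤ k′ → C (q′ l)
    inner′ 0<l l≤k′ with m≤n⇒m<n∨m≡n l≤k′
    ... | inj₁ l<k′ = subst C (sym (proj₂ (prefix l<k′))) (inner 0<l (proj₁ (prefix l<k′)))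
    ... | inj₂ refl = subst C (sym q′k′≡w) cw

  Via-walk : ∀ {C s k q a b} → Via C s k q → q k ≡ a → Walk G C a b →
             Σ ℕ λ k′ → Σ (ℕ → V G) λ q′ → Via C s k′ q′ × q′ k′ ≡ b
  Via-walk via qk≡a (nil _) = _ , _ , via , qk≡a
  Via-walk via qk≡a (cons _ ac walk)
    with Via-extend via (subst (λ v → Edge G v _) (sym qk≡a) ac) (Walk-head walk)
  ... | _ , _ , via′ , q′≡c = Via-walk via′ q′≡c walk

  -- Otherwise the shortest connection from s₁ to s₂ through C closes an induced cycle with x.
  separator-clique : Chordal G → ∀ {C : V G → Set} {x s₁ s₂ a b} →
    (∀ {c} → C c → c ≢ x × NonEdge G x c) → Edge G x s₁ → Edge G x s₂ → s₁ ≢ s₂ →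
    Edge G s₁ a → Walk G C a b → Edge G b s₂ → Edge G s₁ s₂
  separator-clique chordal {C} {x} {s₁} {s₂} avoid xs₁ xs₂ s₁≢s₂ s₁a walk bs₂
    with Via-extend {C} (single s₁ , refl , λ 0<l l≤0 → ⊥-elim (<⇒≱ 0<l l≤0)) s₁a (Walk-head walk)
  ... | _ , _ , via , qk≡a with Via-walk via qk≡a walk
  ... | k , q , (path , q0≡s₁ , inner) , qk≡b
    with InducedPath-extend path (subst (λ v → Edge G v s₂) (sym qk≡b) bs₂)
  ... | zero , r , _ , r0≡q0 , r0≡s₂ , _ =
        contradiction (trans (sym (trans r0≡q0 q0≡s₁)) r0≡s₂) s₁≢s₂
  ... | suc zero , r , path′ , r0≡q0 , r1≡s₂ , _ =
        subst₂ (Edge G) (trans r0≡q0 q0≡s₁) r1≡s₂ (InducedPath.linked path′ (s≤s z≤n))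
  ... | suc (suc k′) , r , path′ , r0≡q0 , rk≡s₂ , prefix =
        ⊥-elim (chordal (_ , s≤s (s≤s (s≤s (s≤s z≤n))) ,
          close-cycle path′ (subst (Edge G x) (sym r0≡s₁) xs₁) (subst (Edge G x) (sym rk≡s₂) xs₂)
            x-ends x-off))
    where
    r0≡s₁ : r 0 ≡ s₁
    r0≡s₁ = trans r0≡q0 q0≡s₁
    inner-r : ∀ {l} → 0 < l → l < suc (suc k′) → C (r l)
    inner-r 0<l l<k = subst C (sym (proj₂ (prefix l<k))) (inner 0<l (proj₁ (prefix l<k)))
    x-ends : ∀ {l} → l ≤ suc (suc k′) → Edge G x (r l) → l ≡ 0 ⊎ l ≡ suc (suc k′)
    x-ends l≤ e with endpoint-or-interior l≤
    ... | inj₁ l≡0 = inj₁ l≡0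
    ... | inj₂ (inj₁ l≡k) = inj₂ l≡k
    ... | inj₂ (inj₂ (0<l , l<k)) = ⊥-elim (edge⇒¬nonEdge G e (proj₂ (avoid (inner-r 0<l l<k))))
    x-off : ∀ {l} → l ≤ suc (suc k′) → r l ≢ x
    x-off l≤ with endpoint-or-interior l≤
    ... | inj₁ refl = λ r0≡x → edge⇒≢ G xs₁ (trans (sym r0≡x) r0≡s₁)
    ... | inj₂ (inj₁ refl) = λ rk≡x → edge⇒≢ G xs₂ (trans (sym rk≡x) rk≡s₂)
    ... | inj₂ (inj₂ (0<l , l<k)) = proj₁ (avoid (inner-r 0<l l<k))

-- Chordal graphs have perfect elimination orderings

record EliminationOrdering (G : Graph) : Set where
  field
    pos           : V G → ℕ
    pos-injective : ∀ {u v} → pos u ≡ pos v → u ≡ v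
    later-clique  : ∀ {v a b} → pos v < pos a → pos v < pos b →
                    Edge G v a → Edge G v b → a ≢ b → Edge G a b

module VertexSets (G : Graph) where

  size : {S : V G → Set} → Decidable₁ S → ℕ
  size S? = Subset.∣ tabulate (isYes ∘ S?) ∣

  private
    ∈⇒member : ∀ {S : V G → Set} (S? : Decidable₁ S) {v} → S v → v Subset.∈ tabulate (isYes ∘ S?)
    ∈⇒member S? {v} sv =
      lookup⇒[]= v _ (trans (lookup∘tabulate (isYes ∘ S?) v)
                            (Equivalence.to Bool.T-≡ (fromWitness {a? = S? v} sv)))

    member⇒∈ : ∀ {S : V G → Set} (S? : Decidable₁ S) {v} → v Subset.∈ tabulate (isYes ∘ S?) → S v
    member⇒∈ S? {v} v∈ =
      toWitness {a? = S? v}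
        (Equivalence.from Bool.T-≡ (trans (sym (lookup∘tabulate (isYes ∘ S?) v)) ([]=⇒lookup v∈)))

  size≤n : ∀ {S : V G → Set} (S? : Decidable₁ S) → size S? ≤ n G
  size≤n S? = ∣p∣≤n (tabulate (isYes ∘ S?))

  size-< : ∀ {S S′ : V G → Set} {u} (S? : Decidable₁ S) (S′? : Decidable₁ S′) →
           (∀ {v} → S v → S′ v) → S′ u → ¬ S u → size S? < size S′?
  size-< S? S′? S⊆S′ u∈S′ u∉S =
    p⊂q⇒∣p∣<∣q∣ {p = tabulate (isYes ∘ S?)} {tabulate (isYes ∘ S′?)}
      ((λ v∈ → ∈⇒member S′? (S⊆S′ (member⇒∈ S? v∈))) , _ , ∈⇒member S′? u∈S′ , u∉S ∘ member⇒∈ S?)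

  size-pos : ∀ {S : V G → Set} {u} (S? : Decidable₁ S) → S u → 0 < size S?
  size-pos S? su = ≤-<-trans z≤n (size-< {S = λ _ → ⊥} (λ _ → no id) S? (λ ()) su id)

  record Component (S : V G → Set) (y : V G) : Set₁ where
    field
      C         : V G → Set
      C?        : Decidable₁ C
      C⊆S       : ∀ {v} → C v → S v
      y∈C       : C y
      connected : ∀ {v} → C v → Walk G C y v
      closed    : ∀ {v w} → C v → S w → Edge G v w → C w

  component : ∀ {S : V G → Set} → Decidable₁ S → ∀ {y} → S y → Component S y
  component {S} S? {y} y∈S = record
    { C = Reach i₀ ; C? = reach? i₀ ; C⊆S = reach⊆S i₀ ; y∈C = reach-y i₀
    ; connected = reach-walk i₀ ; closed = closed }
    where
    Reach : ℕ → V G → Set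
    Reach zero    v = v ≡ y
    Reach (suc i) v = Reach i v ⊎ (S v × ∃ λ u → Reach i u × Edge G u v)

    reach? : ∀ i → Decidable₁ (Reach i)
    reach? zero    v = v Fin.≟ y
    reach? (suc i) v = reach? i v ⊎-dec (S? v ×-dec Fin.any? λ u → reach? i u ×-dec edge? G u v)

    reach⊆S : ∀ i {v} → Reach i v → S v
    reach⊆S zero    refl             = y∈S
    reach⊆S (suc i) (inj₁ r)         = reach⊆S i r
    reach⊆S (suc i) (inj₂ (sv , _))  = sv

    reach-y : ∀ i → Reach i y
    reach-y zero    = refl
    reach-y (suc i) = inj₁ (reach-y i)

    reach-walk : ∀ i {v} → Reach i v → Walk G (Reach i) y v
    reach-walk zero    refl                      = nil refl
    reach-walk (suc i) (inj₁ r)                  = Walk-map inj₁ (reach-walk i r)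
    reach-walk (suc i) (inj₂ new@(_ , _ , ru , uv)) = Walk-snoc (Walk-map inj₁ (reach-walk i ru)) uv (inj₂ new)

    Settled : ℕ → Set
    Settled i = ∀ v → Reach (suc i) v → Reach i v

    -- Each unstable round adds a vertex, and there are only n G vertices.
    growth : ∀ i → Σ ℕ Settled ⊎ suc i ≤ size (reach? i)
    growth zero = inj₂ (size-pos (reach? 0) refl)
    growth (suc i) with growth i
    ... | inj₁ settled = inj₁ settled
    ... | inj₂ grown with Fin.all? (λ v → reach? (suc i) v →-dec reach? i v)
    ...   | yes settled = inj₁ (i , settled)
    ...   | no unstable with Fin.¬∀⟶∃¬ _ _ (λ v → reach? (suc i) v →-dec reach? i v) unstable
    ...     | v , new =
              inj₂ (<-≤-trans (s≤s grown) (size-< (reach? i) (reach? (suc i)) inj₁ added (new ∘ const)))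
      where
      added : Reach (suc i) v
      added with reach? (suc i) v
      ... | yes r  = r
      ... | no ¬r = ⊥-elim (new (⊥-elim ∘ ¬r))

    settled : Σ ℕ Settled
    settled with growth (n G)
    ... | inj₁ st    = st
    ... | inj₂ grown = ⊥-elim (1+n≰n (≤-trans grown (size≤n (reach? (n G)))))

    i₀ : ℕ
    i₀ = proj₁ settled

    closed : ∀ {v w} → Reach i₀ v → S w → Edge G v w → Reach i₀ w
    closed {v} {w} rv sw vw = proj₂ settled w (inj₂ (sw , v , rv , vw))

  SimplicialIn : (V G → Set) → V G → Set
  SimplicialIn S v = S v × (∀ {a b} → S a → S b → Edge G v a → Edge G v b → a ≢ b → Edge G a b)

  IsClique : (V G → Set) → Set
  IsClique S = ∀ {a b} → S a → S b → a ≢ b → Edge G a b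

  clique-or-nonEdge : ∀ {S : V G → Set} → Decidable₁ S →
    IsClique S ⊎ Σ (V G) λ a → Σ (V G) λ b → S a × S b × a ≢ b × NonEdge G a b
  clique-or-nonEdge {S} S? with Fin.any? (λ a → Fin.any? λ b →
                                  S? a ×-dec (S? b ×-dec (¬? (a Fin.≟ b) ×-dec nonEdge? G a b)))
  ... | yes (a , b , pair) = inj₂ (a , b , pair)
  ... | no none = inj₁ clique
    where
    clique : IsClique S
    clique {a} {b} sa sb a≢b with edge-or-nonEdge G a b
    ... | inj₁ e  = e
    ... | inj₂ ne = ⊥-elim (none (a , b , sa , sb , a≢b , ne))

  SimplicialNonNeighbour : (V G → Set) → V G → Set
  SimplicialNonNeighbour S x = Σ (V G) λ v → SimplicialIn S v × v ≢ x × NonEdge G x v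

module Dirac {G : Graph} (chordal : Chordal G) where
  open VertexSets G

  -- Dirac's lemma in the form that carries the induction. Let C be the component of y in S
  -- minus the closed neighbourhood of x, and B the vertices of S outside C with a neighbour in C.
  -- B is a clique by separator-clique, so two applications of the induction hypothesis to C ∪ B
  -- yield a simplicial vertex lying in C, which is then simplicial in S as well.
  module Step {S} (S? : Decidable₁ S)
         (IH : ∀ {S₁} (S₁? : Decidable₁ S₁) → size S₁? < size S? →
               ∀ {x y} → S₁ x → S₁ y → x ≢ y → NonEdge G x y → SimplicialNonNeighbour S₁ x)
         {x y} (x∈S : S x) (y∈S : S y) (x≢y : x ≢ y) (xy : NonEdge G x y) where

    Far : V G → Set
    Far v = S v × v ≢ x × NonEdge G x v

    far? : Decidable₁ Far
    far? v = S? v ×-dec (¬? (v Fin.≟ x) ×-dec nonEdge? G x v)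

    open Component (component far? (y∈S , x≢y ∘ sym , xy))

    Boundary : V G → Set
    Boundary v = S v × ¬ C v × ∃ λ c → C c × Edge G c v

    boundary? : Decidable₁ Boundary
    boundary? v = S? v ×-dec (¬? (C? v) ×-dec Fin.any? λ c → C? c ×-dec edge? G c v)

    S₁ : V G → Set
    S₁ v = C v ⊎ Boundary v

    S₁? : Decidable₁ S₁
    S₁? v = C? v ⊎-dec boundary? v

    C-far : ∀ {c} → C c → c ≢ x × NonEdge G x c
    C-far cc = proj₂ (C⊆S cc)

    boundary-adjacent : ∀ {v} → Boundary v → Edge G x v
    boundary-adjacent {v} (sv , v∉C , c , cc , cv) with edge-or-nonEdge G x v | v Fin.≟ x
    ... | inj₁ xv | _       = xv
    ... | inj₂ _  | yes refl = ⊥-elim (edge⇒¬nonEdge G (edge-sym G cv) (proj₂ (C-far cc)))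
    ... | inj₂ ne | no v≢x  = ⊥-elim (v∉C (closed cc (sv , v≢x , ne) cv))

    boundary-clique : IsClique Boundary
    boundary-clique ba@(_ , _ , ca , cca , ca-a) bb@(_ , _ , cb , ccb , cb-b) a≢b =
      separator-clique chordal C-far (boundary-adjacent ba) (boundary-adjacent bb) a≢b (edge-sym G ca-a)
        (Walk-reverse (connected cca) ++ʷ connected ccb) cb-b

    S₁⊆S : ∀ {v} → S₁ v → S v
    S₁⊆S (inj₁ cv)        = proj₁ (C⊆S cv)
    S₁⊆S (inj₂ (sv , _))  = sv

    x∉S₁ : ¬ S₁ x
    x∉S₁ (inj₁ cx)                  = proj₁ (C-far cx) refl
    x∉S₁ (inj₂ (_ , _ , c , cc , cx)) = edge⇒¬nonEdge G (edge-sym G cx) (proj₂ (C-far cc))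

    smaller : size S₁? < size S?
    smaller = size-< S₁? S? S₁⊆S x∈S x∉S₁

    neighbour-of-C : ∀ {v w} → C v → S w → Edge G v w → S₁ w
    neighbour-of-C {w = w} cv sw vw with C? w
    ... | yes cw = inj₁ cw
    ... | no w∉C = inj₂ (sw , w∉C , _ , cv , vw)

    from-component : ∀ {v} → C v → SimplicialIn S₁ v → SimplicialNonNeighbour S x
    from-component {v} cv (_ , simplicial) =
      v , (proj₁ (C⊆S cv) , λ sa sb va vb → simplicial (neighbour-of-C cv sa va) (neighbour-of-C cv sb vb) va vb) ,
      C-far cv

    simplicial-nonNeighbour : SimplicialNonNeighbour S x
    simplicial-nonNeighbour with clique-or-nonEdge S₁?
    ... | inj₁ clique =
          y , (y∈S , λ sa sb ya yb → clique (neighbour-of-C y∈C sa ya) (neighbour-of-C y∈C sb yb)) ,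
          x≢y ∘ sym , xy
    ... | inj₂ (p , q , s₁p , s₁q , p≢q , pq) with IH S₁? smaller s₁p s₁q p≢q pq
    ...   | v₁ , (inj₁ cv₁ , simplicial₁) , _ , _ = from-component cv₁ (inj₁ cv₁ , simplicial₁)
    ...   | v₁ , simp₁@(inj₂ bv₁ , _) , v₁≢p , pv₁
      with IH S₁? smaller (proj₁ simp₁) s₁p v₁≢p (nonEdge-sym G pv₁)
    ...     | v₂ , (inj₁ cv₂ , simplicial₂) , _ , _ = from-component cv₂ (inj₁ cv₂ , simplicial₂)
    ...     | v₂ , (inj₂ bv₂ , _) , v₂≢v₁ , v₁v₂ =
              ⊥-elim (edge⇒¬nonEdge G (boundary-clique bv₁ bv₂ (v₂≢v₁ ∘ sym)) v₁v₂)

  simplicial-nonNeighbour : ∀ fuel {S} (S? : Decidable₁ S) → size S? < fuel →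
             ∀ {x y} → S x → S y → x ≢ y → NonEdge G x y → SimplicialNonNeighbour S x
  simplicial-nonNeighbour (suc fuel) S? bound =
    Step.simplicial-nonNeighbour S?
      (λ S₁? smaller → simplicial-nonNeighbour fuel S₁? (<-≤-trans smaller (s≤s⁻¹ bound)))

  simplicial-exists : ∀ {S} (S? : Decidable₁ S) {u} → S u → Σ (V G) (SimplicialIn S)
  simplicial-exists S? {u} su with clique-or-nonEdge S?
  ... | inj₁ clique = u , su , λ sa sb _ _ → clique sa sb
  ... | inj₂ (a , b , sa , sb , a≢b , ab) with simplicial-nonNeighbour _ S? ≤-refl sa sb a≢b ab
  ...   | v , simplicial , _ = v , simplicial

  record EliminationOrderingOn (S : V G → Set) : Set where
    field
      pos           : V G → ℕ
      pos-injective : ∀ {u v} → S u → S v → pos u ≡ pos v → u ≡ v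
      later-clique  : ∀ {v a b} → S v → S a → S b → pos v < pos a → pos v < pos b →
                      Edge G v a → Edge G v b → a ≢ b → Edge G a b

  eliminate-first : ∀ {S v} → SimplicialIn S v → EliminationOrderingOn (λ w → S w × w ≢ v) →
                    EliminationOrderingOn S
  eliminate-first {S} {v} (_ , v-simplicial) rest = record
    { pos = pos ; pos-injective = pos-injective ; later-clique = later-clique }
    where
    module R = EliminationOrderingOn rest

    pos : V G → ℕ
    pos w with w Fin.≟ v
    ... | yes _ = 0
    ... | no _  = suc (R.pos w)

    pos-v : pos v ≡ 0
    pos-v with v Fin.≟ v
    ... | yes _   = refl
    ... | no v≢v = contradiction refl v≢v

    pos-other : ∀ {w} → w ≢ v → pos w ≡ suc (R.pos w)
    pos-other {w} w≢v with w Fin.≟ v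
    ... | yes w≡v = contradiction w≡v w≢v
    ... | no _    = refl

    after-v : ∀ {w m} → m < pos w → w ≢ v
    after-v m<w refl = n≮0 (subst (_ <_) pos-v m<w)

    pos-injective : ∀ {u w} → S u → S w → pos u ≡ pos w → u ≡ w
    pos-injective {u} {w} su sw eq with u Fin.≟ v | w Fin.≟ v
    ... | yes refl | yes refl = refl
    ... | yes refl | no _     = contradiction eq 0≢1+n
    ... | no _     | yes refl = contradiction (sym eq) 0≢1+n
    ... | no u≢v   | no w≢v   = R.pos-injective (su , u≢v) (sw , w≢v) (suc-injective eq)

    later-clique : ∀ {u a b} → S u → S a → S b → pos u < pos a → pos u < pos b →
                   Edge G u a → Edge G u b → a ≢ b → Edge G a b
    later-clique {u} su sa sb u<a u<b with u Fin.≟ v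
    ... | yes refl = v-simplicial sa sb
    ... | no u≢v   = R.later-clique (su , u≢v) (sa , after-v u<a) (sb , after-v u<b) (shift u<a) (shift u<b)
      where
      shift : ∀ {w} → suc (R.pos u) < pos w → R.pos u < R.pos w
      shift u<w = s≤s⁻¹ (subst (_ <_) (pos-other (after-v u<w)) u<w)

  eliminationOrderingOn : ∀ fuel {S} (S? : Decidable₁ S) → size S? < fuel → EliminationOrderingOn S
  eliminationOrderingOn (suc fuel) {S} S? bound with Fin.any? S?
  ... | no empty = record
        { pos = λ _ → 0
        ; pos-injective = λ su → ⊥-elim (empty (_ , su))
        ; later-clique  = λ sv → ⊥-elim (empty (_ , sv))
        }
  ... | yes (u , su) with simplicial-exists S? su
  ...   | v , simplicial = eliminate-first simplicial
          (eliminationOrderingOn fuel rest? (<-≤-trans smaller (s≤s⁻¹ bound)))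
    where
    rest? : Decidable₁ (λ w → S w × w ≢ v)
    rest? w = S? w ×-dec ¬? (w Fin.≟ v)
    smaller : size rest? < size S?
    smaller = size-< rest? S? proj₁ (proj₁ simplicial) (λ r → proj₂ r refl)

chordal⇒eliminationOrdering : ∀ {G} → Chordal G → EliminationOrdering G
chordal⇒eliminationOrdering {G} chordal = record
  { pos = pos
  ; pos-injective = pos-injective _ _
  ; later-clique  = later-clique _ _ _
  }
  where
  open Dirac {G} chordal
  open EliminationOrderingOn (eliminationOrderingOn _ {λ _ → ⊤} (λ _ → yes tt) ≤-refl)

-- Simplicial vertices of minors of chordal graphs

-- Opaque because unfolding the list search makes unification in later proofs blow up.
opaque
  argmax-on : ∀ {k} {P : Fin k → Set} → Decidable₁ P → (f : Fin k → ℕ) → ∀ {c} → P c →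
              Σ (Fin k) λ i → P i × (∀ {v} → P v → f v ≤ f i)
  argmax-on {k} {P} P? f {c} pc =
    argmax f c xs ,
    argmax-all f {P = P} {c} {xs} pc (All.tabulate (proj₂ ∘ ∈-filter⁻ P? {xs = allFin k})) ,
    λ {v} pv → All.lookup (f[xs]≤f[argmax] {f = f} c xs) (∈-filter⁺ P? (∈-allFin v) pv)
    where
    xs : List (Fin k)
    xs = filter P? (allFin k)

  argmin-on : ∀ {k} (f : Fin k → ℕ) → Fin k → Σ (Fin k) λ i → ∀ v → f i ≤ f v
  argmin-on {k} f c =
    argmin f c (allFin k) , λ v → All.lookup (f[argmin]≤f[xs] {f = f} c (allFin k)) (∈-allFin v)

Simplicial : (H : Graph) → V H → Set
Simplicial H x = ∀ {y z} → Edge H x y → Edge H x z → y ≢ z → Edge H y z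

module _ {G : Graph} (E : EliminationOrdering G) where
  open EliminationOrdering E

  Below : ℕ → V G → Set
  Below m w = pos w < m

  ReachesBelow : ℕ → V G → V G → Set
  ReachesBelow m c v = c ≡ v ⊎ Σ (V G) λ p → Walk G (Below m) c p × Edge G p v

  walk-split : ∀ m {a b} → Walk G (Below (suc m)) a b →
               Walk G (Below m) a b ⊎
               (Σ (V G) λ v → pos v ≡ m × ReachesBelow m a v) × (Σ (V G) λ v → pos v ≡ m × ReachesBelow m b v)
  walk-split m {a} (nil a<1+m) with m<1+n⇒m<n∨m≡n a<1+m
  ... | inj₁ a<m = inj₁ (nil a<m)
  ... | inj₂ a≡m = inj₂ ((a , a≡m , inj₁ refl) , (a , a≡m , inj₁ refl))
  walk-split m {a} (cons {c = c} a<1+m e w) with m<1+n⇒m<n∨m≡n a<1+m | walk-split m w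
  ... | inj₂ a≡m | inj₁ w′ =
        inj₂ ((a , a≡m , inj₁ refl) , (a , a≡m , inj₂ (c , Walk-reverse w′ , edge-sym G e)))
  ... | inj₂ a≡m | inj₂ (_ , end) = inj₂ ((a , a≡m , inj₁ refl) , end)
  ... | inj₁ a<m | inj₁ w′ = inj₁ (cons a<m e w′)
  ... | inj₁ a<m | inj₂ ((v , v≡m , inj₁ refl) , end) = inj₂ ((v , v≡m , inj₂ (a , nil a<m , e)) , end)
  ... | inj₁ a<m | inj₂ ((v , v≡m , inj₂ (p , w′ , pv)) , end) =
        inj₂ ((v , v≡m , inj₂ (p , cons a<m e w′ , pv)) , end)

  -- If the walk meets the vertex v of position m, both w and w′ are later neighbours of v
  -- (by induction), so the elimination ordering makes them adjacent.
  lower-walk⇒edge : ∀ m {a b w w′} → Walk G (Below m) a b → Edge G w a → Edge G w′ b →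
                    m ≤ pos w → m ≤ pos w′ → w ≢ w′ → Edge G w w′
  lower-walk⇒edge zero    walk _ _ _ _ _ = ⊥-elim (n≮0 (Walk-head walk))
  lower-walk⇒edge (suc m) {w = w} {w′} walk wa w′b m<w m<w′ w≢w′ with walk-split m walk
  ... | inj₁ walk′ = lower-walk⇒edge m walk′ wa w′b (<⇒≤ m<w) (<⇒≤ m<w′) w≢w′
  ... | inj₂ ((v , v≡m , av) , (v′ , v′≡m , bv′)) with pos-injective (trans v≡m (sym v′≡m))
  ...   | refl = later-clique (subst (_< pos w) (sym v≡m) m<w) (subst (_< pos w′) (sym v≡m) m<w′)
                   (edge-sym G (joined wa m<w av)) (edge-sym G (joined w′b m<w′ bv′)) w≢w′
    where
    joined : ∀ {u c} → Edge G u c → m < pos u → ReachesBelow m c v → Edge G u v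
    joined uc _   (inj₁ refl) = uc
    joined uc m<u (inj₂ (p , walk′ , pv)) =
      lower-walk⇒edge m walk′ uc (edge-sym G pv) (<⇒≤ m<u) (≤-reflexive (sym v≡m))
        (λ { refl → <-irrefl (sym v≡m) m<u })

  LinkedBelow : V G → V G → Set
  LinkedBelow u a = a ≡ u ⊎ Σ (V G) λ r → Edge G u r × Walk G (Below (pos u)) a r

  linkedBelow-≤ : ∀ {u a} → LinkedBelow u a → pos a ≤ pos u
  linkedBelow-≤ (inj₁ refl)          = ≤-refl
  linkedBelow-≤ (inj₂ (_ , _ , walk)) = <⇒≤ (Walk-head walk)

  walk⇒later-neighbour : ∀ {Q : V G → Set} {u a b} → Walk G Q a b → LinkedBelow u a → pos u < pos b →
           Σ (V G) λ q → Q q × Edge G u q × pos u < pos q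
  walk⇒later-neighbour (nil _) ua u<a = ⊥-elim (<⇒≱ u<a (linkedBelow-≤ ua))
  walk⇒later-neighbour {u = u} {a} (cons {c = c} _ ac walk) ua u<b with pos c ≤? pos u
  ... | no c≰u = c , Walk-head walk , u~c ua , ≰⇒> c≰u
    where
    u~c : LinkedBelow u a → Edge G u c
    u~c (inj₁ refl) = ac
    u~c (inj₂ (r , ur , ar)) =
      edge-sym G (lower-walk⇒edge (pos u) ar (edge-sym G ac) ur (<⇒≤ (≰⇒> c≰u)) ≤-refl
                    (λ { refl → c≰u ≤-refl }))
  ... | yes c≤u with c Fin.≟ u
  ...   | yes refl = walk⇒later-neighbour walk (inj₁ refl) u<b
  ...   | no c≢u   = walk⇒later-neighbour walk (linked ua) u<b
    where
    c<u : pos c < pos u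
    c<u = ≤∧≢⇒< c≤u (c≢u ∘ pos-injective)
    linked : LinkedBelow u a → LinkedBelow u c
    linked (inj₁ refl)          = inj₂ (c , ac , nil c<u)
    linked (inj₂ (r , ur , ar)) = inj₂ (r , ur , cons c<u (edge-sym G ac) ar)

  -- The branch set whose top vertex comes first in the ordering is simplicial in the minor.
  shallowMinor-simplicial : ∀ {t H} → IsShallowMinor t H G → V H → Σ (V H) (Simplicial H)
  shallowMinor-simplicial {t} {H} M x = x₀ , x₀-simplicial
    where
    open ShallowMinor {t} {H} {G} M

    InBranch? : ∀ x → Decidable₁ (InBranch x)
    InBranch? x v = ≡-dec Fin._≟_ (proj₁ M v) (just x)

    top-spec : ∀ x → Σ (V G) λ u → InBranch x u × (∀ {v} → InBranch x v → pos v ≤ pos u)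
    top-spec x = argmax-on (InBranch? x) pos (centre∈ x)

    top : V H → V G
    top x = proj₁ (top-spec x)

    top∈ : ∀ x → InBranch x (top x)
    top∈ x = proj₁ (proj₂ (top-spec x))

    top-max : ∀ {x v} → InBranch x v → pos v ≤ pos (top x)
    top-max {x} = proj₂ (proj₂ (top-spec x))

    x₀-spec : Σ (V H) λ x₀ → ∀ y → pos (top x₀) ≤ pos (top y)
    x₀-spec = argmin-on (pos ∘ top) x

    x₀ : V H
    x₀ = proj₁ x₀-spec

    x₀-min : ∀ y → pos (top x₀) ≤ pos (top y)
    x₀-min = proj₂ x₀-spec

    neighbour-above : ∀ {y} → Edge H x₀ y →
                      Σ (V G) λ q → InBranch y q × Edge G (top x₀) q × pos (top x₀) < pos q
    neighbour-above {y} x₀y with edge⇒link (edge⇒≢ H x₀y) x₀y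
    ... | u , v , x₀u , yv , uv =
          in-y (walk⇒later-neighbour {Q = λ w → InBranch x₀ w ⊎ InBranch y w} path (inj₁ refl) top-order)
      where
      top-order : pos (top x₀) < pos (top y)
      top-order = ≤∧≢⇒< (x₀-min y) (branches-disjoint (edge⇒≢ H x₀y) (top∈ x₀) (top∈ y) ∘ pos-injective)
      path : Walk G (λ w → InBranch x₀ w ⊎ InBranch y w) (top x₀) (top y)
      path = Walk-map inj₁ (branch-walk (top∈ x₀) x₀u) ++ʷ
             cons (inj₁ x₀u) uv (Walk-map inj₂ (branch-walk yv (top∈ y)))
      in-y : (Σ (V G) λ q → (InBranch x₀ q ⊎ InBranch y q) × Edge G (top x₀) q × pos (top x₀) < pos q) →
             Σ (V G) λ q → InBranch y q × Edge G (top x₀) q × pos (top x₀) < pos q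
      in-y (q , inj₂ yq  , x₀q , above) = q , yq , x₀q , above
      in-y (q , inj₁ x₀q , _   , above) = ⊥-elim (<⇒≱ above (top-max x₀q))

    x₀-simplicial : Simplicial H x₀
    x₀-simplicial {y} {z} x₀y x₀z y≢z with neighbour-above x₀y | neighbour-above x₀z
    ... | qy , yqy , x₀qy , qy-above | qz , zqz , x₀qz , qz-above =
      link⇒edge y≢z (qy , qz , yqy , zqz ,
        later-clique qy-above qz-above x₀qy x₀qz (branches-disjoint y≢z yqy zqz))

cover-nonempty : ∀ {H x j} → CliqueCoverOn H (ClosedNbhd H x) j → 1 ≤ j
cover-nonempty {x = x} (colour , _) = <-≤-trans (s≤s z≤n) (Fin.toℕ<n (colour x (inj₁ refl)))

simplicial⇒β≡1 : ∀ {H x} → Simplicial H x → IsBetaAt H x 1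
simplicial⇒β≡1 {H} {x} simplicial = ((λ _ _ → fzero) , one-clique) , λ _ → cover-nonempty {H} {x}
  where
  one-clique : ∀ u v (su : ClosedNbhd H x u) (sv : ClosedNbhd H x v) → u ≢ v → fzero ≡ fzero → Edge H u v
  one-clique u v (inj₁ refl) (inj₁ refl) u≢v _ = contradiction refl u≢v
  one-clique u v (inj₁ refl) (inj₂ xv)   _   _ = xv
  one-clique u v (inj₂ xu)   (inj₁ refl) _   _ = edge-sym H xu
  one-clique u v (inj₂ xu)   (inj₂ xv)   u≢v _ = simplicial xu xv u≢v


point-shallowMinor : ∀ t G → V G → IsShallowMinor t (Star 0) G
point-shallowMinor t G v = inducedStar⇒shallowMinor {t} {G} {G} {v} (shallowMinor-refl t G)
  (record { leaf = λ () ; spoke = λ () ; apart = λ { {()} } })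

point-β̃≡1 : IsBetaTilde (Star 0) 1
point-β̃≡1 = (fzero , simplicial⇒β≡1 {Star 0} point-simplicial) ,
             λ y _ β → cover-nonempty {Star 0} {y} (proj₁ β)
  where
  point-simplicial : Simplicial (Star 0) fzero
  point-simplicial {fzero} ()

chordal⇒β̂≡1 : ∀ t G → 1 ≤ n G → Chordal G → IsBetaHat t G 1
chordal⇒β̂≡1 t G 1≤n chordal = (Star 0 , point-shallowMinor t G (fromℕ< 1≤n) , point-β̃≡1) , β̃≤1
  where
  β̃≤1 : ∀ H j → IsShallowMinor t H G → IsBetaTilde H j → j ≤ 1
  β̃≤1 H j M ((x , _) , minimal) with shallowMinor-simplicial (chordal⇒eliminationOrdering chordal) {t} {H} M x
  ... | x₀ , simplicial = minimal x₀ 1 (simplicial⇒β≡1 {H} simplicial)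

incomparability⇒β̃≤s : ∀ t s G → Incomparability G → ¬ IsShallowMinor t (Star s) G →
                       ∀ H j → IsShallowMinor t H G → IsBetaTilde H j → j ≤ s
incomparability⇒β̃≤s t s G incomparable no-star H j M ((x , _ , minimal) , _) =
  minimal s (neighbourhood-cover H (shallowMinor-incomparability {t} {H} {G} M incomparable) x s
               (no-star ∘ inducedStar⇒shallowMinor {t} {H} {G} M))

theorem2p1 : (t : ℕ) →
      ((G : Graph) → 1 ≤ n G → Chordal G → IsBetaHat t G 1)
    × ((s : ℕ) → 1 ≤ s → (G : Graph) → Incomparability G →
        ¬ IsShallowMinor t (Star s) G →
        (H : Graph) (j : ℕ) → IsShallowMinor t H G → IsBetaTilde H j → j ≤ s)
-- The hypothesis 1 ≤ s is unused: every vertex carries an induced star with no leaves.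
theorem2p1 t = chordal⇒β̂≡1 t , λ s _ → incomparability⇒β̃≤s t s
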